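{- Let $m\in\mathbb{N}$, $m\ge1$, and let $I_0,I_1,I_2,\dots$ be a random walk on $\mathbb{Z}$ starting at an integer $I_0$ whose increments $I_{k+1}-I_k$ are i.i.d., each distributed as the difference of two independent random variables uniformly distributed in $\{0,1,\dots,m\}$. Let $T$ be the minimal time with $I_T=0$. Then for every positive integer $r$, $\mathbb{E}[\min(T,r)]\le O\big((m+|I_0|/m)\sqrt r\big)$.
   Context: The constant in $O(\cdot)$ is absolute (independent of $m$, $I_0$ and $r$). -}

module Defs where

open import Data.Nat as ℕ using (ℕ; zero; suc; NonZero)
open import Data.Nat.Properties using (m^n≢0)
open import Data.Integer as ℤ using (ℤ; +_)
open import Data.Product using (_×_; _,_)
open import Data.List using (List; []; _∷_; map; concatMap; upTo)
open import Data.Nat.ListAction using (sum)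
open import Relation.Nullary using (yes; no)
open import Data.Rational as ℚ using (ℚ)

vals : ℕ → List ℕ
vals m = upTo (suc m)

-- Outcomes (a , b) of the two independent uniforms; the increment is a - b.
pairs : ℕ → List (ℕ × ℕ)
pairs m = concatMap (λ a → map (λ b → (a , b)) (vals m)) (vals m)

-- All sequences of r outcomes: the (uniform) sample space of the
-- first r increments, of size ((m+1)²)^r.
paths : ℕ → ℕ → List (List (ℕ × ℕ))
paths m zero    = [] ∷ []
paths m (suc r) = concatMap (λ p → map (p ∷_) (paths m r)) (pairs m)

-- For a path of length r started at I₀ this is exactly min(T, r), where
-- T = min { t ≥ 0 : I_t = 0 }.
cappedHit : ℤ → List (ℕ × ℕ) → ℕ
cappedHit i [] = 0
cappedHit i ((a , b) ∷ ps) with i ℤ.≟ + 0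
... | yes _ = 0
... | no  _ = suc (cappedHit (i ℤ.+ + a ℤ.- + b) ps)

nzPow : ∀ m r → NonZero ((suc m ℕ.* suc m) ℕ.^ r)
nzPow m r = m^n≢0 (suc m ℕ.* suc m) r

expMinTr : ℕ → ℤ → ℕ → ℚ
expMinTr m I₀ r =
  (+ sum (map (cappedHit I₀) (paths m r))) ℚ./ ((suc m ℕ.* suc m) ℕ.^ r)
  where instance _ = nzPow m r

-- Let n = m + 1. Summing min(T, t) over the n^(2t) equally likely step sequences turns
-- E[min(T, t)] into an integer recursion in t. Fix a scale s ≥ 6 with R ≤ s², put L = 8sm and
-- φ(0) = 0, φ(j) = 4Lm² + L|j| − 6j² for j ≠ 0. As the increment has mean 0 and variance
-- m(m+2)/6, one step from j ≠ 0 lowers the expectation of φ by at least m² (the kink of φ at 0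
-- helps on balance); moreover φ ≥ 0 for |j| ≤ sm and φ ≥ m²R for sm < |j| ≤ sm + m. Induction on t
-- gives m²·E[min(T, t)] ≤ φ(I₀) for t ≤ R and |I₀| ≤ sm: inside the region a step costs m² and is
-- paid for by the drift of φ, and a walk that steps out of it is already charged φ ≥ m²R.
-- Hence m·E[min(T, R)] ≤ 32s(m² + |I₀|); for |I₀| > sm this follows from min(T, R) ≤ R ≤ s².
-- Taking s = 6t with R ≤ t² ≤ 4R yields E[min(T, R)] ≤ 384 (m + |I₀|/m) √R.

module Submission where

open import Defs
open import Data.Nat as ℕ using (ℕ; NonZero)
open import Data.Integer as ℤ using (ℤ; +_)
open import Data.Rational as ℚ using (ℚ)
open import Data.Product using (∃)

open import Data.Empty using (⊥-elim)
open import Data.Integer using (0ℤ; 1ℤ; -_; _+_; _-_; _*_; _≤_; ∣_∣; +≤+; +[1+_]; -[1+_])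
import Data.Integer.Properties as ℤP
open import Algebra.Properties.CommutativeSemigroup ℤP.+-commutativeSemigroup using (interchange)
open import Data.Integer.Tactic.RingSolver using (solve-∀)
open import Data.List using (List; []; _∷_; _++_; map; concatMap; applyUpTo; upTo; length)
open import Data.List.Properties using (map-∘; map-cong; map-++; length-map; length-++; applyUpTo-∷ʳ; map-applyUpTo)
open import Data.Nat using (zero; suc; z≤n; s≤s)
open import Data.Nat.ListAction using (sum)
open import Data.Nat.ListAction.Properties using (sum-++)
import Data.Nat.Properties as ℕP
import Data.Nat.Tactic.RingSolver as ℕ-Solver
open import Data.Product using (_×_; _,_)
open import Data.Rational using (toℚᵘ)
import Data.Rational.Properties as ℚP
open import Data.Rational.Unnormalised as ℚᵘ using (mkℚᵘ; _≃_; *≤*)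
import Data.Rational.Unnormalised.Properties as ℚᵘP
open import Function using (_∘_)
open import Relation.Binary.PropositionalEquality
open import Relation.Nullary using (yes; no)

*-nonNeg : ∀ {i j} → 0ℤ ≤ i → 0ℤ ≤ j → 0ℤ ≤ i * j
*-nonNeg {i} {j} 0≤i 0≤j =
  subst (_≤ i * j) (ℤP.*-zeroʳ i) (ℤP.*-monoˡ-≤-nonNeg i {{ℤ.nonNegative 0≤i}} 0≤j)

0≤+ : ∀ n → 0ℤ ≤ + n
0≤+ n = +≤+ z≤n

∑ : ℕ → (ℕ → ℤ) → ℤ
∑ zero    f = 0ℤ
∑ (suc n) f = ∑ n f + f n

∑-cong : ∀ n {f g} → (∀ k → f k ≡ g k) → ∑ n f ≡ ∑ n g
∑-cong zero    f≗g = refl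
∑-cong (suc n) f≗g = cong₂ _+_ (∑-cong n f≗g) (f≗g n)

∑-mono-≤ : ∀ n {f g} → (∀ k → k ℕ.< n → f k ≤ g k) → ∑ n f ≤ ∑ n g
∑-mono-≤ zero    f≤g = ℤP.≤-refl
∑-mono-≤ (suc n) f≤g =
  ℤP.+-mono-≤ (∑-mono-≤ n (λ k k<n → f≤g k (ℕP.m<n⇒m<1+n k<n))) (f≤g n ℕP.≤-refl)

∑-distrib-+ : ∀ n f g → ∑ n (λ k → f k + g k) ≡ ∑ n f + ∑ n g
∑-distrib-+ zero    f g = refl
∑-distrib-+ (suc n) f g =
  trans (cong (_+ (f n + g n)) (∑-distrib-+ n f g)) (interchange (∑ n f) (∑ n g) (f n) (g n))

*-distribˡ-∑ : ∀ n c f → c * ∑ n f ≡ ∑ n (λ k → c * f k)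
*-distribˡ-∑ zero    c f = ℤP.*-zeroʳ c
*-distribˡ-∑ (suc n) c f =
  trans (ℤP.*-distribˡ-+ c (∑ n f) (f n)) (cong (_+ c * f n) (*-distribˡ-∑ n c f))

*-distribʳ-∑ : ∀ n c f → ∑ n f * c ≡ ∑ n (λ k → f k * c)
*-distribʳ-∑ n c f = trans (ℤP.*-comm (∑ n f) c)
                           (trans (*-distribˡ-∑ n c f) (∑-cong n (λ k → ℤP.*-comm c (f k))))

∑-const : ∀ n c → ∑ n (λ _ → c) ≡ + n * c
∑-const zero    c = sym (ℤP.*-zeroˡ c)
∑-const (suc n) c = trans (cong (_+ c) (∑-const n c))
                          (trans (ℤP.+-comm (+ n * c) c) (sym (ℤP.suc-* (+ n) c)))

∑-comm : ∀ n p (f : ℕ → ℕ → ℤ) → ∑ n (λ a → ∑ p (f a)) ≡ ∑ p (λ b → ∑ n (λ a → f a b))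
∑-comm zero    p f = sym (trans (∑-const p 0ℤ) (ℤP.*-zeroʳ (+ p)))
∑-comm (suc n) p f = trans (cong (_+ ∑ p (f n)) (∑-comm n p f))
                           (sym (∑-distrib-+ p (λ b → ∑ n (λ a → f a b)) (f n)))

∑-≤-single : ∀ n f D k → k ℕ.≤ n → (∀ b → b ℕ.≤ n → b ≢ k → f b ≤ D) → ∑ (suc n) f ≤ f k + + n * D
∑-≤-single zero    f D zero k≤n others≤D =
  ℤP.≤-reflexive (trans (ℤP.+-identityˡ (f 0)) (sym (ℤP.+-identityʳ (f 0))))
∑-≤-single (suc n) f D k k≤n others≤D with k ℕ.≟ suc n
... | yes refl = begin
  ∑ (suc n) f + f (suc n)    ≤⟨ ℤP.+-monoˡ-≤ (f (suc n)) (∑-mono-≤ (suc n) (λ b b<1+n →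
                                 others≤D b (ℕP.<⇒≤ b<1+n) (ℕP.<⇒≢ b<1+n))) ⟩
  ∑ (suc n) (λ _ → D) + f k  ≡⟨ cong (_+ f k) (∑-const (suc n) D) ⟩
  + suc n * D + f k          ≡⟨ ℤP.+-comm (+ suc n * D) (f k) ⟩
  f k + + suc n * D          ∎
  where open ℤP.≤-Reasoning
... | no k≢1+n = begin
  ∑ (suc n) f + f (suc n)    ≤⟨ ℤP.+-mono-≤ (∑-≤-single n f D k (ℕP.≤-pred (ℕP.≤∧≢⇒< k≤n k≢1+n))
                                                (λ b b≤n → others≤D b (ℕP.m≤n⇒m≤1+n b≤n)))
                                             (others≤D (suc n) ℕP.≤-refl (k≢1+n ∘ sym)) ⟩
  f k + + n * D + D          ≡⟨ ℤP.+-assoc (f k) (+ n * D) D ⟩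
  f k + (+ n * D + D)        ≡⟨ cong (λ x → f k + x) (trans (ℤP.+-comm (+ n * D) D) (sym (ℤP.suc-* (+ n) D))) ⟩
  f k + + suc n * D          ∎
  where open ℤP.≤-Reasoning

∑² : ℕ → (ℕ → ℕ → ℤ) → ℤ
∑² n F = ∑ n (λ a → ∑ n (F a))

∑²-cong : ∀ n {F G} → (∀ a b → F a b ≡ G a b) → ∑² n F ≡ ∑² n G
∑²-cong n F≗G = ∑-cong n (λ a → ∑-cong n (F≗G a))

∑²-mono-≤ : ∀ n {F G} → (∀ a b → a ℕ.< n → b ℕ.< n → F a b ≤ G a b) → ∑² n F ≤ ∑² n G
∑²-mono-≤ n F≤G = ∑-mono-≤ n (λ a a<n → ∑-mono-≤ n (λ b b<n → F≤G a b a<n b<n))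

∑²-distrib-+ : ∀ n F G → ∑² n (λ a b → F a b + G a b) ≡ ∑² n F + ∑² n G
∑²-distrib-+ n F G = trans (∑-cong n (λ a → ∑-distrib-+ n (F a) (G a))) (∑-distrib-+ n _ _)

*-distribˡ-∑² : ∀ n c F → c * ∑² n F ≡ ∑² n (λ a b → c * F a b)
*-distribˡ-∑² n c F = trans (*-distribˡ-∑ n c _) (∑-cong n (λ a → *-distribˡ-∑ n c (F a)))

∑²-const : ∀ n c → ∑² n (λ _ _ → c) ≡ + n * + n * c
∑²-const n c = begin
  ∑ n (λ _ → ∑ n (λ _ → c))  ≡⟨ ∑-cong n (λ _ → ∑-const n c) ⟩
  ∑ n (λ _ → + n * c)        ≡⟨ ∑-const n (+ n * c) ⟩
  + n * (+ n * c)            ≡⟨ ℤP.*-assoc (+ n) (+ n) c ⟨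
  + n * + n * c              ∎
  where open ≡-Reasoning

∑²-product : ∀ n f g → ∑² n (λ a b → f a * g b) ≡ ∑ n f * ∑ n g
∑²-product n f g = begin
  ∑ n (λ a → ∑ n (λ b → f a * g b))  ≡⟨ ∑-cong n (λ a → *-distribˡ-∑ n (f a) g) ⟨
  ∑ n (λ a → f a * ∑ n g)            ≡⟨ *-distribʳ-∑ n (∑ n g) f ⟨
  ∑ n f * ∑ n g                      ∎
  where open ≡-Reasoning

∑²-swap : ∀ n F → ∑² n F ≡ ∑² n (λ a b → F b a)
∑²-swap n F = ∑-comm n n F

∑-id : ∀ n → + 2 * ∑ n (λ k → + k) ≡ + n * (+ n - 1ℤ)
∑-id zero    = refl
∑-id (suc n) = begin
  + 2 * (∑ n (λ k → + k) + + n)      ≡⟨ ℤP.*-distribˡ-+ (+ 2) (∑ n (λ k → + k)) (+ n) ⟩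
  + 2 * ∑ n (λ k → + k) + + 2 * + n  ≡⟨ cong (_+ + 2 * + n) (∑-id n) ⟩
  + n * (+ n - 1ℤ) + + 2 * + n       ≡⟨ step (+ n) ⟩
  + suc n * (+ suc n - 1ℤ)           ∎
  where
  open ≡-Reasoning
  step : ∀ x → x * (x - 1ℤ) + + 2 * x ≡ (1ℤ + x) * ((1ℤ + x) - 1ℤ)
  step = solve-∀

∑-square : ∀ n → + 6 * ∑ n (λ k → + k * + k) ≡ (+ n - 1ℤ) * + n * (+ 2 * + n - 1ℤ)
∑-square zero    = refl
∑-square (suc n) = begin
  + 6 * (∑ n (λ k → + k * + k) + + n * + n)          ≡⟨ ℤP.*-distribˡ-+ (+ 6) (∑ n (λ k → + k * + k)) (+ n * + n) ⟩
  + 6 * ∑ n (λ k → + k * + k) + + 6 * (+ n * + n)    ≡⟨ cong (_+ + 6 * (+ n * + n)) (∑-square n) ⟩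
  (+ n - 1ℤ) * + n * (+ 2 * + n - 1ℤ) + + 6 * (+ n * + n)
                                                     ≡⟨ step (+ n) ⟩
  (+ suc n - 1ℤ) * + suc n * (+ 2 * + suc n - 1ℤ)    ∎
  where
  open ≡-Reasoning
  step : ∀ x → (x - 1ℤ) * x * (+ 2 * x - 1ℤ) + + 6 * (x * x)
             ≡ ((1ℤ + x) - 1ℤ) * (1ℤ + x) * (+ 2 * (1ℤ + x) - 1ℤ)
  step = solve-∀

∑²-diff : ∀ n → ∑² n (λ a b → + a - + b) ≡ 0ℤ
∑²-diff n = begin
  ∑² n (λ a b → + a - + b)
    ≡⟨ ∑²-cong n (λ a b → split (+ a) (+ b)) ⟩
  ∑² n (λ a b → + a * 1ℤ + (- 1ℤ) * + b)
    ≡⟨ ∑²-distrib-+ n _ _ ⟩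
  ∑² n (λ a b → + a * 1ℤ) + ∑² n (λ a b → (- 1ℤ) * + b)
    ≡⟨ cong₂ _+_ (∑²-product n (λ a → + a) (λ _ → 1ℤ)) (∑²-product n (λ _ → - 1ℤ) (λ b → + b)) ⟩
  S₁ * ∑ n (λ _ → 1ℤ) + ∑ n (λ _ → - 1ℤ) * S₁
    ≡⟨ cong₂ (λ x y → S₁ * x + y * S₁) (∑-const n 1ℤ) (∑-const n (- 1ℤ)) ⟩
  S₁ * (+ n * 1ℤ) + (+ n * - 1ℤ) * S₁
    ≡⟨ cancel S₁ (+ n) ⟩
  0ℤ ∎
  where
  open ≡-Reasoning
  S₁ = ∑ n (λ k → + k)
  split : ∀ x y → x - y ≡ x * 1ℤ + (- 1ℤ) * y
  split = solve-∀
  cancel : ∀ s x → s * (x * 1ℤ) + (x * - 1ℤ) * s ≡ 0ℤ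
  cancel = solve-∀

∑²-diff-square : ∀ n → + 6 * ∑² n (λ a b → (+ a - + b) * (+ a - + b)) ≡ + n * + n * (+ n * + n - 1ℤ)
∑²-diff-square n = begin
  + 6 * ∑² n (λ a b → (+ a - + b) * (+ a - + b))
    ≡⟨ cong (+ 6 *_) (∑²-cong n (λ a b → expand (+ a) (+ b))) ⟩
  + 6 * ∑² n (λ a b → (+ a * + a) * 1ℤ + (- + 2 * + a * + b + 1ℤ * (+ b * + b)))
    ≡⟨ cong (+ 6 *_) (trans (∑²-distrib-+ n _ _)
                            (cong (λ x → ∑² n (λ a b → (+ a * + a) * 1ℤ) + x) (∑²-distrib-+ n _ _))) ⟩
  + 6 * (∑² n (λ a b → (+ a * + a) * 1ℤ)
         + (∑² n (λ a b → (- + 2 * + a) * + b) + ∑² n (λ a b → 1ℤ * (+ b * + b))))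
    ≡⟨ cong (+ 6 *_) (cong₂ _+_ (∑²-product n _ _) (cong₂ _+_ (∑²-product n _ _) (∑²-product n _ _))) ⟩
  + 6 * (S₂ * ∑ n (λ _ → 1ℤ) + (∑ n (λ a → - + 2 * + a) * S₁ + ∑ n (λ _ → 1ℤ) * S₂))
    ≡⟨ cong₂ (λ c d → + 6 * (S₂ * c + (d * S₁ + c * S₂)))
             (∑-const n 1ℤ) (sym (*-distribˡ-∑ n (- + 2) (λ a → + a))) ⟩
  + 6 * (S₂ * (+ n * 1ℤ) + (- + 2 * S₁ * S₁ + (+ n * 1ℤ) * S₂))
    ≡⟨ regroup (+ n) S₁ S₂ ⟩
  + 2 * + n * (+ 6 * S₂) - + 3 * (+ 2 * S₁) * (+ 2 * S₁)
    ≡⟨ cong₂ (λ x y → + 2 * + n * x - + 3 * y * y) (∑-square n) (∑-id n) ⟩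
  + 2 * + n * ((+ n - 1ℤ) * + n * (+ 2 * + n - 1ℤ)) - + 3 * (+ n * (+ n - 1ℤ)) * (+ n * (+ n - 1ℤ))
    ≡⟨ closedForm (+ n) ⟩
  + n * + n * (+ n * + n - 1ℤ) ∎
  where
  open ≡-Reasoning
  S₁ = ∑ n (λ k → + k)
  S₂ = ∑ n (λ k → + k * + k)
  expand : ∀ x y → (x - y) * (x - y) ≡ (x * x) * 1ℤ + (- + 2 * x * y + 1ℤ * (y * y))
  expand = solve-∀
  regroup : ∀ x s t → + 6 * (t * (x * 1ℤ) + (- + 2 * s * s + (x * 1ℤ) * t))
                    ≡ + 2 * x * (+ 6 * t) - + 3 * (+ 2 * s) * (+ 2 * s)
  regroup = solve-∀
  closedForm : ∀ x → + 2 * x * ((x - 1ℤ) * x * (+ 2 * x - 1ℤ)) - + 3 * (x * (x - 1ℤ)) * (x * (x - 1ℤ))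
                   ≡ x * x * (x * x - 1ℤ)
  closedForm = solve-∀

sum-concatMap : ∀ {A B : Set} (f : B → ℕ) (g : A → List B) xs →
                sum (map f (concatMap g xs)) ≡ sum (map (λ x → sum (map f (g x))) xs)
sum-concatMap f g []       = refl
sum-concatMap f g (x ∷ xs) = begin
  sum (map f (g x ++ concatMap g xs))                     ≡⟨ cong sum (map-++ f (g x) _) ⟩
  sum (map f (g x) ++ map f (concatMap g xs))             ≡⟨ sum-++ (map f (g x)) _ ⟩
  sum (map f (g x)) ℕ.+ sum (map f (concatMap g xs))      ≡⟨ cong (sum (map f (g x)) ℕ.+_) (sum-concatMap f g xs) ⟩
  sum (map (λ x → sum (map f (g x))) (x ∷ xs))            ∎
  where open ≡-Reasoning

sum-applyUpTo : ∀ (f : ℕ → ℕ) n → + sum (applyUpTo f n) ≡ ∑ n (λ k → + f k)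
sum-applyUpTo f zero    = refl
sum-applyUpTo f (suc n) = begin
  + sum (applyUpTo f (suc n))              ≡⟨ cong (+_ ∘ sum) (applyUpTo-∷ʳ f n) ⟨
  + sum (applyUpTo f n ++ f n ∷ [])        ≡⟨ cong +_ (sum-++ (applyUpTo f n) (f n ∷ [])) ⟩
  + (sum (applyUpTo f n) ℕ.+ (f n ℕ.+ 0))  ≡⟨ ℤP.pos-+ (sum (applyUpTo f n)) _ ⟩
  + sum (applyUpTo f n) + + (f n ℕ.+ 0)    ≡⟨ cong₂ _+_ (sum-applyUpTo f n) (cong +_ (ℕP.+-identityʳ (f n))) ⟩
  ∑ n (λ k → + f k) + + f n                ∎
  where open ≡-Reasoning

sum-map-upTo : ∀ (f : ℕ → ℕ) n → + sum (map f (upTo n)) ≡ ∑ n (λ k → + f k)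
sum-map-upTo f n = trans (cong (+_ ∘ sum) (map-applyUpTo (λ k → k) f n)) (sum-applyUpTo f n)

sum-pairs : ∀ m (F : ℕ × ℕ → ℕ) → + sum (map F (pairs m)) ≡ ∑² (suc m) (λ a b → + F (a , b))
sum-pairs m F = begin
  + sum (map F (pairs m))
    ≡⟨ cong +_ (sum-concatMap F (λ a → map (a ,_) (vals m)) (vals m)) ⟩
  + sum (map (λ a → sum (map F (map (a ,_) (vals m)))) (vals m))
    ≡⟨ sum-map-upTo _ (suc m) ⟩
  ∑ (suc m) (λ a → + sum (map F (map (a ,_) (vals m))))
    ≡⟨ ∑-cong (suc m) (λ a → trans (cong (+_ ∘ sum) (sym (map-∘ (vals m)))) (sum-map-upTo (λ b → F (a , b)) (suc m))) ⟩
  ∑² (suc m) (λ a b → + F (a , b)) ∎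
  where open ≡-Reasoning

length-concatMap : ∀ {A B : Set} (g : A → List B) xs → length (concatMap g xs) ≡ sum (map (length ∘ g) xs)
length-concatMap g []       = refl
length-concatMap g (x ∷ xs) = trans (length-++ (g x)) (cong (length (g x) ℕ.+_) (length-concatMap g xs))

sum-map-suc : ∀ {A : Set} (f : A → ℕ) xs → sum (map (suc ∘ f) xs) ≡ length xs ℕ.+ sum (map f xs)
sum-map-suc f []       = refl
sum-map-suc f (x ∷ xs) = begin
  suc (f x ℕ.+ sum (map (suc ∘ f) xs))      ≡⟨ cong (λ s → suc (f x ℕ.+ s)) (sum-map-suc f xs) ⟩
  suc (f x ℕ.+ (length xs ℕ.+ sum (map f xs))) ≡⟨ cong suc (ℕP.+-assoc (f x) (length xs) _) ⟨
  suc (f x ℕ.+ length xs ℕ.+ sum (map f xs))   ≡⟨ cong (λ s → suc (s ℕ.+ sum (map f xs))) (ℕP.+-comm (f x) (length xs)) ⟩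
  suc (length xs ℕ.+ f x ℕ.+ sum (map f xs))   ≡⟨ cong suc (ℕP.+-assoc (length xs) (f x) _) ⟩
  suc (length xs ℕ.+ (f x ℕ.+ sum (map f xs))) ∎
  where open ≡-Reasoning

#paths : ℕ → ℕ → ℕ
#paths m t = (suc m ℕ.* suc m) ℕ.^ t

#paths-suc : ∀ m t → + #paths m (suc t) ≡ + suc m * + suc m * + #paths m t
#paths-suc m t = trans (ℤP.pos-* (suc m ℕ.* suc m) (#paths m t))
                       (cong (_* + #paths m t) (ℤP.pos-* (suc m) (suc m)))

length-paths : ∀ m t → length (paths m t) ≡ #paths m t
length-paths m zero    = refl
length-paths m (suc t) = ℤP.+-injective (begin
  + length (paths m (suc t))
    ≡⟨ cong +_ (length-concatMap (λ p → map (p ∷_) (paths m t)) (pairs m)) ⟩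
  + sum (map (λ p → length (map (p ∷_) (paths m t))) (pairs m))
    ≡⟨ sum-pairs m (λ p → length (map (p ∷_) (paths m t))) ⟩
  ∑² (suc m) (λ a b → + length (map ((a , b) ∷_) (paths m t)))
    ≡⟨ ∑²-cong (suc m) (λ a b → cong +_ (trans (length-map ((a , b) ∷_) (paths m t)) (length-paths m t))) ⟩
  ∑² (suc m) (λ _ _ → + #paths m t)
    ≡⟨ ∑²-const (suc m) (+ #paths m t) ⟩
  + suc m * + suc m * + #paths m t
    ≡⟨ #paths-suc m t ⟨
  + #paths m (suc t) ∎)
  where open ≡-Reasoning

-- #paths m t · E[min(T, t)] for the walk started at i.
cappedHitSum : ℕ → ℕ → ℤ → ℕ
cappedHitSum m t i = sum (map (cappedHit i) (paths m t))

cappedHit-0 : ∀ ps → cappedHit 0ℤ ps ≡ 0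
cappedHit-0 []      = refl
cappedHit-0 (_ ∷ _) = refl

cappedHitSum-0 : ∀ m t → cappedHitSum m t 0ℤ ≡ 0
cappedHitSum-0 m t = allZero (paths m t)
  where
  allZero : ∀ pss → sum (map (cappedHit 0ℤ) pss) ≡ 0
  allZero []         = refl
  allZero (ps ∷ pss) = cong₂ ℕ._+_ (cappedHit-0 ps) (allZero pss)

cappedHit-∷ : ∀ {i} a b ps → i ≢ 0ℤ → cappedHit i ((a , b) ∷ ps) ≡ suc (cappedHit (i + + a - + b) ps)
cappedHit-∷ {i} a b ps i≢0 with i ℤ.≟ 0ℤ
... | yes i≡0 = ⊥-elim (i≢0 i≡0)
... | no  _   = refl

cappedHitSum-suc : ∀ m t {i} → i ≢ 0ℤ →
  + cappedHitSum m (suc t) i ≡ ∑² (suc m) (λ a b → + #paths m t + + cappedHitSum m t (i + + a - + b))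
cappedHitSum-suc m t {i} i≢0 = begin
  + sum (map (cappedHit i) (concatMap (λ p → map (p ∷_) (paths m t)) (pairs m)))
    ≡⟨ cong +_ (sum-concatMap (cappedHit i) (λ p → map (p ∷_) (paths m t)) (pairs m)) ⟩
  + sum (map (λ p → sum (map (cappedHit i) (map (p ∷_) (paths m t)))) (pairs m))
    ≡⟨ sum-pairs m _ ⟩
  ∑² (suc m) (λ a b → + sum (map (cappedHit i) (map ((a , b) ∷_) (paths m t))))
    ≡⟨ ∑²-cong (suc m) (λ a b → cong +_ (afterStep a b)) ⟩
  ∑² (suc m) (λ a b → + (#paths m t ℕ.+ cappedHitSum m t (i + + a - + b)))
    ≡⟨ ∑²-cong (suc m) (λ a b → ℤP.pos-+ (#paths m t) _) ⟩
  ∑² (suc m) (λ a b → + #paths m t + + cappedHitSum m t (i + + a - + b)) ∎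
  where
  open ≡-Reasoning
  afterStep : ∀ a b → sum (map (cappedHit i) (map ((a , b) ∷_) (paths m t)))
                      ≡ #paths m t ℕ.+ cappedHitSum m t (i + + a - + b)
  afterStep a b = begin
    sum (map (cappedHit i) (map ((a , b) ∷_) (paths m t)))
      ≡⟨ cong sum (sym (map-∘ (paths m t))) ⟩
    sum (map (cappedHit i ∘ ((a , b) ∷_)) (paths m t))
      ≡⟨ cong sum (map-cong (λ ps → cappedHit-∷ a b ps i≢0) (paths m t)) ⟩
    sum (map (suc ∘ cappedHit (i + + a - + b)) (paths m t))
      ≡⟨ sum-map-suc (cappedHit (i + + a - + b)) (paths m t) ⟩
    length (paths m t) ℕ.+ cappedHitSum m t (i + + a - + b)
      ≡⟨ cong (ℕ._+ cappedHitSum m t (i + + a - + b)) (length-paths m t) ⟩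
    #paths m t ℕ.+ cappedHitSum m t (i + + a - + b) ∎

cappedHitSum-≤ : ∀ m t i → + cappedHitSum m t i ≤ + t * + #paths m t
cappedHitSum-≤ m zero    i = +≤+ ℕ.z≤n
cappedHitSum-≤ m (suc t) i with i ℤ.≟ 0ℤ
... | yes refl = subst (_≤ + suc t * + #paths m (suc t)) (cong +_ (sym (cappedHitSum-0 m (suc t))))
                   (*-nonNeg (0≤+ (suc t)) (0≤+ (#paths m (suc t))))
... | no  i≢0  = begin
  + cappedHitSum m (suc t) i
    ≡⟨ cappedHitSum-suc m t i≢0 ⟩
  ∑² (suc m) (λ a b → + #paths m t + + cappedHitSum m t (i + + a - + b))
    ≤⟨ ∑²-mono-≤ (suc m) (λ a b _ _ → ℤP.+-monoʳ-≤ (+ #paths m t) (cappedHitSum-≤ m t _)) ⟩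
  ∑² (suc m) (λ _ _ → + #paths m t + + t * + #paths m t)
    ≡⟨ ∑²-const (suc m) _ ⟩
  + suc m * + suc m * (+ #paths m t + + t * + #paths m t)
    ≡⟨ regroup (+ suc m * + suc m) (+ t) (+ #paths m t) ⟩
  + suc t * (+ suc m * + suc m * + #paths m t)
    ≡⟨ cong (+ suc t *_) (#paths-suc m t) ⟨
  + suc t * + #paths m (suc t) ∎
  where
  open ℤP.≤-Reasoning
  regroup : ∀ c x ℓ → c * (ℓ + x * ℓ) ≡ (1ℤ + x) * (c * ℓ)
  regroup = solve-∀

∣i+a-b∣≤∣i∣+m : ∀ i {a b m} → a ℕ.≤ m → b ℕ.≤ m → ∣ i + + a - + b ∣ ℕ.≤ ∣ i ∣ ℕ.+ m
∣i+a-b∣≤∣i∣+m i {a} {b} {m} a≤m b≤m = begin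
  ∣ i + + a - + b ∣        ≡⟨ cong ∣_∣ (ℤP.+-assoc i (+ a) (- + b)) ⟩
  ∣ i + (+ a - + b) ∣      ≤⟨ ℤP.∣i+j∣≤∣i∣+∣j∣ i (+ a - + b) ⟩
  ∣ i ∣ ℕ.+ ∣ + a - + b ∣  ≡⟨ cong (λ x → ∣ i ∣ ℕ.+ ∣ x ∣) (ℤP.m-n≡m⊖n a b) ⟩
  ∣ i ∣ ℕ.+ ∣ a ℤ.⊖ b ∣    ≤⟨ ℕP.+-monoʳ-≤ ∣ i ∣ (ℕP.≤-trans (ℤP.∣m⊝n∣≤m⊔n a b)
                                                              (ℕP.⊔-lub a≤m b≤m)) ⟩
  ∣ i ∣ ℕ.+ m              ∎
  where open ℕP.≤-Reasoning

module LyapunovBound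
  (m B R : ℕ) (c : ℤ) (0≤c : 0ℤ ≤ c) (φ : ℤ → ℤ)
  (φ-nonNeg : ∀ j → ∣ j ∣ ℕ.≤ B → 0ℤ ≤ φ j)
  (φ-exit   : ∀ j → B ℕ.< ∣ j ∣ → ∣ j ∣ ℕ.≤ B ℕ.+ m → c * + R ≤ φ j)
  (φ-drift  : ∀ i → i ≢ 0ℤ → ∣ i ∣ ℕ.≤ B →
              ∑² (suc m) (λ a b → c + φ (i + + a - + b)) ≤ + suc m * + suc m * φ i)
  where

  cappedHitSum-bound : ∀ t → t ℕ.≤ R → ∀ i → ∣ i ∣ ℕ.≤ B → c * + cappedHitSum m t i ≤ + #paths m t * φ i
  cappedHitSum-bound zero    _   i ∣i∣≤B = begin
    c * 0ℤ     ≡⟨ ℤP.*-zeroʳ c ⟩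
    0ℤ         ≤⟨ φ-nonNeg i ∣i∣≤B ⟩
    φ i        ≡⟨ ℤP.*-identityˡ (φ i) ⟨
    1ℤ * φ i   ∎
    where open ℤP.≤-Reasoning
  cappedHitSum-bound (suc t) t<R i ∣i∣≤B with i ℤ.≟ 0ℤ
  ... | yes refl = begin
    c * + cappedHitSum m (suc t) 0ℤ  ≡⟨ cong (λ h → c * + h) (cappedHitSum-0 m (suc t)) ⟩
    c * 0ℤ                          ≡⟨ ℤP.*-zeroʳ c ⟩
    0ℤ                              ≤⟨ *-nonNeg (0≤+ (#paths m (suc t))) (φ-nonNeg 0ℤ ℕ.z≤n) ⟩
    + #paths m (suc t) * φ 0ℤ       ∎
    where open ℤP.≤-Reasoning
  ... | no i≢0 = begin
    c * + cappedHitSum m (suc t) i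
      ≡⟨ cong (c *_) (cappedHitSum-suc m t i≢0) ⟩
    c * ∑² (suc m) (λ a b → P + + cappedHitSum m t (i + + a - + b))
      ≡⟨ *-distribˡ-∑² (suc m) c _ ⟩
    ∑² (suc m) (λ a b → c * (P + + cappedHitSum m t (i + + a - + b)))
      ≤⟨ ∑²-mono-≤ (suc m) (λ a b a<n b<n → afterStep (i + + a - + b)
                              (ℕP.≤-trans (∣i+a-b∣≤∣i∣+m i (ℕP.≤-pred a<n) (ℕP.≤-pred b<n))
                                          (ℕP.+-monoˡ-≤ m ∣i∣≤B))) ⟩
    ∑² (suc m) (λ a b → P * (c + φ (i + + a - + b)))
      ≡⟨ *-distribˡ-∑² (suc m) P _ ⟨
    P * ∑² (suc m) (λ a b → c + φ (i + + a - + b))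
      ≤⟨ ℤP.*-monoˡ-≤-nonNeg P (φ-drift i i≢0 ∣i∣≤B) ⟩
    P * (+ suc m * + suc m * φ i)
      ≡⟨ ℤP.*-assoc P (+ suc m * + suc m) (φ i) ⟨
    P * (+ suc m * + suc m) * φ i
      ≡⟨ cong (_* φ i) (trans (ℤP.*-comm P _) (sym (#paths-suc m t))) ⟩
    + #paths m (suc t) * φ i ∎
    where
    open ℤP.≤-Reasoning
    P = + #paths m t
    t≤R : t ℕ.≤ R
    t≤R = ℕP.<⇒≤ t<R
    cappedHitSum-bound-t : ∀ j → ∣ j ∣ ℕ.≤ B ℕ.+ m → c * + cappedHitSum m t j ≤ P * φ j
    cappedHitSum-bound-t j ∣j∣≤B+m with ∣ j ∣ ℕ.≤? B
    ... | yes ∣j∣≤B = cappedHitSum-bound t t≤R j ∣j∣≤B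
    ... | no  ∣j∣≰B = begin
      c * + cappedHitSum m t j  ≤⟨ ℤP.*-monoˡ-≤-nonNeg c {{ℤ.nonNegative 0≤c}} (cappedHitSum-≤ m t j) ⟩
      c * (+ t * P)             ≤⟨ ℤP.*-monoˡ-≤-nonNeg c {{ℤ.nonNegative 0≤c}} (ℤP.*-monoʳ-≤-nonNeg P (+≤+ t≤R)) ⟩
      c * (+ R * P)             ≡⟨ reorder c (+ R) P ⟩
      P * (c * + R)             ≤⟨ ℤP.*-monoˡ-≤-nonNeg P (φ-exit j (ℕP.≰⇒> ∣j∣≰B) ∣j∣≤B+m) ⟩
      P * φ j                   ∎
      where
      reorder : ∀ x y z → x * (y * z) ≡ z * (x * y)
      reorder = solve-∀
    afterStep : ∀ j → ∣ j ∣ ℕ.≤ B ℕ.+ m → c * (P + + cappedHitSum m t j) ≤ P * (c + φ j)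
    afterStep j ∣j∣≤B+m = begin
      c * (P + + cappedHitSum m t j)  ≡⟨ ℤP.*-distribˡ-+ c P _ ⟩
      c * P + c * + cappedHitSum m t j ≤⟨ ℤP.+-monoʳ-≤ (c * P) (cappedHitSum-bound-t j ∣j∣≤B+m) ⟩
      c * P + P * φ j                 ≡⟨ cong (_+ P * φ j) (ℤP.*-comm c P) ⟩
      P * c + P * φ j                 ≡⟨ ℤP.*-distribˡ-+ P c (φ j) ⟨
      P * (c + φ j)                   ∎

Ψ : ℤ → ℤ → ℤ → ℤ
Ψ Z M y = + 4 * (+ 8 * Z) * (M * M) + (+ 8 * Z) * y - + 6 * (y * y)

Ψ-nonNeg : ∀ y d m → 0ℤ ≤ Ψ (+ y + + d) (+ m) (+ y)
Ψ-nonNeg y d m = begin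
  0ℤ
    ≤⟨ ℤP.+-mono-≤ (*-nonNeg (*-nonNeg (0≤+ 32) (ℤP.+-mono-≤ (0≤+ y) (0≤+ d))) (*-nonNeg (0≤+ m) (0≤+ m)))
                   (ℤP.+-mono-≤ (*-nonNeg (0≤+ 2) (*-nonNeg (0≤+ y) (0≤+ y)))
                                (*-nonNeg (0≤+ 8) (*-nonNeg (0≤+ d) (0≤+ y)))) ⟩
  + 32 * (+ y + + d) * (+ m * + m) + (+ 2 * (+ y * + y) + + 8 * (+ d * + y))
    ≡⟨ certificate (+ y) (+ d) (+ m) ⟨
  Ψ (+ y + + d) (+ m) (+ y) ∎
  where
  open ℤP.≤-Reasoning
  certificate : ∀ Y D M → + 4 * (+ 8 * (Y + D)) * (M * M) + (+ 8 * (Y + D)) * Y - + 6 * (Y * Y)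
                        ≡ + 32 * (Y + D) * (M * M) + (+ 2 * (Y * Y) + + 8 * (D * Y))
  certificate = solve-∀

-- For s = 6 + u and m = d + e, Ψ (s m) m (s m + d) - m² s² has only nonnegative coefficients.
Ψ-exit : ∀ u d e → let S = + 6 + + u ; M = + d + + e in M * M * (S * S) ≤ Ψ (S * M) M (S * M + + d)
Ψ-exit u d e = begin
  M * M * (S * S)      ≤⟨ ℤP.i≤i+j (M * M * (S * S)) w {{ℤ.nonNegative 0≤w}} ⟩
  M * M * (S * S) + w  ≡⟨ certificate (+ u) (+ d) (+ e) ⟨
  Ψ (S * M) M (S * M + + d) ∎
  where
  open ℤP.≤-Reasoning
  S = + 6 + + u
  M = + d + + e
  w : ℤ
  w = + 32 * S * M * (M * M)
      + ((+ 6 + + 8 * + u + + u * + u) * (M * M) + (+ 4 * S * M * + e + + 6 * + e * (+ 2 * + d + + e)))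
  0≤w : 0ℤ ≤ w
  0≤w = ℤP.+-mono-≤ (*-nonNeg (*-nonNeg (*-nonNeg (0≤+ 32) 0≤S) 0≤M) (*-nonNeg 0≤M 0≤M))
          (ℤP.+-mono-≤ (*-nonNeg (ℤP.+-mono-≤ (ℤP.+-mono-≤ (0≤+ 6) (*-nonNeg (0≤+ 8) (0≤+ u))) (*-nonNeg (0≤+ u) (0≤+ u)))
                                 (*-nonNeg 0≤M 0≤M))
                       (ℤP.+-mono-≤ (*-nonNeg (*-nonNeg (*-nonNeg (0≤+ 4) 0≤S) 0≤M) (0≤+ e))
                                    (*-nonNeg (*-nonNeg (0≤+ 6) (0≤+ e)) (ℤP.+-mono-≤ (*-nonNeg (0≤+ 2) (0≤+ d)) (0≤+ e)))))
    where
    0≤S : 0ℤ ≤ S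
    0≤S = ℤP.+-mono-≤ (0≤+ 6) (0≤+ u)
    0≤M : 0ℤ ≤ M
    0≤M = ℤP.+-mono-≤ (0≤+ d) (0≤+ e)
  certificate : ∀ U D E →
    + 4 * (+ 8 * ((+ 6 + U) * (D + E))) * ((D + E) * (D + E))
      + (+ 8 * ((+ 6 + U) * (D + E))) * ((+ 6 + U) * (D + E) + D)
      - + 6 * (((+ 6 + U) * (D + E) + D) * ((+ 6 + U) * (D + E) + D))
      ≡ (D + E) * (D + E) * ((+ 6 + U) * (+ 6 + U))
        + (+ 32 * (+ 6 + U) * (D + E) * ((D + E) * (D + E))
           + ((+ 6 + + 8 * U + U * U) * ((D + E) * (D + E))
              + (+ 4 * (+ 6 + U) * (D + E) * E + + 6 * E * (+ 2 * D + E))))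
  certificate = solve-∀

module Potential (m s : ℕ) where

  M S L : ℤ
  M = + m
  S = + s
  L = + 8 * (S * M)

  0≤L : 0ℤ ≤ L
  0≤L = *-nonNeg (0≤+ 8) (*-nonNeg (0≤+ s) (0≤+ m))

  0≤L*M : 0ℤ ≤ L * M
  0≤L*M = *-nonNeg 0≤L (0≤+ m)

  ψ : ℤ → ℤ
  ψ = Ψ (S * M) M

  φ : ℤ → ℤ
  φ (+ zero) = 0ℤ
  φ +[1+ k ] = ψ +[1+ k ]
  φ -[1+ k ] = ψ +[1+ k ]

  -- δ corrects the parabola ψ to φ across the kink at 0 (φ-≤-ψ+δ) and costs nothing on
  -- average over a step (∑-δ-≤-0).
  δ : ℤ → ℤ
  δ (+ zero) = - (+ 4 * L * (M * M))
  δ +[1+ k ] = 0ℤ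
  δ -[1+ k ] = + 2 * L * M

  φ-≤-ψ+δ : ∀ j → - M ≤ j → φ j ≤ ψ j + δ j
  φ-≤-ψ+δ (+ zero) _ = ℤP.≤-reflexive (cancel (+ 4 * L * (M * M)) L)
    where
    cancel : ∀ A L → 0ℤ ≡ A + L * 0ℤ - + 6 * (0ℤ * 0ℤ) + - A
    cancel = solve-∀
  φ-≤-ψ+δ +[1+ k ] _ = ℤP.≤-reflexive (sym (ℤP.+-identityʳ (ψ +[1+ k ])))
  φ-≤-ψ+δ -[1+ k ] -M≤j = begin
    ψ Y                    ≡⟨ reflect (+ 4 * L * (M * M)) L Y ⟩
    ψ (- Y) + + 2 * L * Y  ≤⟨ ℤP.+-monoʳ-≤ (ψ (- Y)) (ℤP.*-monoˡ-≤-nonNeg (+ 2 * L) {{ℤ.nonNegative 0≤2L}} Y≤M) ⟩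
    ψ (- Y) + + 2 * L * M  ∎
    where
    open ℤP.≤-Reasoning
    Y = +[1+ k ]
    Y≤M : Y ≤ M
    Y≤M = subst (Y ≤_) (ℤP.neg-involutive M) (ℤP.neg-mono-≤ -M≤j)
    0≤2L : 0ℤ ≤ + 2 * L
    0≤2L = *-nonNeg (0≤+ 2) 0≤L
    reflect : ∀ A L y → A + L * y - + 6 * (y * y) ≡ A + L * (- y) - + 6 * (- y * - y) + + 2 * L * y
    reflect = solve-∀

  δ-≤ : ∀ j → δ j ≤ + 2 * L * M
  δ-≤ (+ zero) = ℤP.≤-trans (ℤP.neg-mono-≤ 0≤4LMM) (*-nonNeg (*-nonNeg (0≤+ 2) 0≤L) (0≤+ m))
    where
    0≤4LMM : 0ℤ ≤ + 4 * L * (M * M)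
    0≤4LMM = *-nonNeg (*-nonNeg (0≤+ 4) 0≤L) (*-nonNeg (0≤+ m) (0≤+ m))
  δ-≤ +[1+ k ] = *-nonNeg (*-nonNeg (0≤+ 2) 0≤L) (0≤+ m)
  δ-≤ -[1+ k ] = ℤP.≤-refl

  δ-positive : ∀ {c b} → b ℕ.< c → δ (+ c - + b) ≡ 0ℤ
  δ-positive {c} {b} b<c =
    trans (cong δ (trans (ℤP.m-n≡m⊖n c b) (ℤP.⊖-≥ (ℕP.<⇒≤ b<c)))) (δ-+ (ℕP.m<n⇒0<n∸m b<c))
    where
    δ-+ : ∀ {k} → 0 ℕ.< k → δ (+ k) ≡ 0ℤ
    δ-+ {suc _} _ = refl

  ∑-δ-≤-0 : ∀ c → ∑ (suc m) (λ b → δ (+ c - + b)) ≤ 0ℤ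
  ∑-δ-≤-0 c with c ℕ.≤? m
  ... | yes c≤m = begin
    ∑ (suc m) (λ b → δ (+ c - + b))    ≤⟨ ∑-≤-single m _ (+ 2 * L * M) c c≤m (λ b _ _ → δ-≤ (+ c - + b)) ⟩
    δ (+ c - + c) + M * (+ 2 * L * M)  ≡⟨ cong (λ j → δ j + M * (+ 2 * L * M)) (ℤP.+-inverseʳ (+ c)) ⟩
    - (+ 4 * L * (M * M)) + M * (+ 2 * L * M) ≡⟨ collect L M ⟩
    - (+ 2 * (L * M) * M)              ≤⟨ ℤP.neg-mono-≤ (*-nonNeg (*-nonNeg (0≤+ 2) 0≤L*M) (0≤+ m)) ⟩
    0ℤ                                 ∎
    where
    open ℤP.≤-Reasoning
    collect : ∀ L M → - (+ 4 * L * (M * M)) + M * (+ 2 * L * M) ≡ - (+ 2 * (L * M) * M)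
    collect = solve-∀
  ... | no c≰m = begin
    ∑ (suc m) (λ b → δ (+ c - + b))  ≤⟨ ∑-mono-≤ (suc m) (λ b b<1+m → ℤP.≤-reflexive
                                          (δ-positive (ℕP.≤-<-trans (ℕP.≤-pred b<1+m) (ℕP.≰⇒> c≰m)))) ⟩
    ∑ (suc m) (λ _ → 0ℤ)             ≡⟨ ∑-const (suc m) 0ℤ ⟩
    + suc m * 0ℤ                     ≡⟨ ℤP.*-zeroʳ (+ suc m) ⟩
    0ℤ                               ∎
    where
    open ℤP.≤-Reasoning

  ∑²-drift : ∑² (suc m) (λ a b → M * M - + 6 * ((+ a - + b) * (+ a - + b))) ≡ - (+ 2 * (+ suc m * + suc m * M))
  ∑²-drift = begin
    ∑² n (λ a b → M * M + - (+ 6 * X² a b))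
      ≡⟨ ∑²-distrib-+ n _ _ ⟩
    ∑² n (λ _ _ → M * M) + ∑² n (λ a b → - (+ 6 * X² a b))
      ≡⟨ cong₂ _+_ (∑²-const n (M * M)) (∑²-cong n (λ a b → ℤP.neg-distribˡ-* (+ 6) (X² a b))) ⟩
    + n * + n * (M * M) + ∑² n (λ a b → - + 6 * X² a b)
      ≡⟨ cong (λ v → + n * + n * (M * M) + v) (sym (*-distribˡ-∑² n (- + 6) X²)) ⟩
    + n * + n * (M * M) + - + 6 * ∑² n X²
      ≡⟨ cong (λ v → + n * + n * (M * M) + v) (sym (ℤP.neg-distribˡ-* (+ 6) (∑² n X²))) ⟩
    + n * + n * (M * M) + - (+ 6 * ∑² n X²)
      ≡⟨ cong (λ v → + n * + n * (M * M) + - v) (∑²-diff-square n) ⟩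
    + n * + n * (M * M) + - (+ n * + n * (+ n * + n - 1ℤ))
      ≡⟨ simplify M ⟩
    - (+ 2 * (+ n * + n * M)) ∎
    where
    open ≡-Reasoning
    n = suc m
    X² : ℕ → ℕ → ℤ
    X² a b = (+ a - + b) * (+ a - + b)
    simplify : ∀ M → (1ℤ + M) * (1ℤ + M) * (M * M) + - ((1ℤ + M) * (1ℤ + M) * ((1ℤ + M) * (1ℤ + M) - 1ℤ))
                   ≡ - (+ 2 * ((1ℤ + M) * (1ℤ + M) * M))
    simplify = solve-∀

  -M≤1+p+a-b : ∀ p a {b} → b ℕ.≤ m → - M ≤ +[1+ p ] + + a - + b
  -M≤1+p+a-b p a {b} b≤m = ℤP.≤-trans (ℤP.neg-mono-≤ (+≤+ b≤m)) (ℤP.i≤j+i (- + b) (+ (suc p ℕ.+ a)))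

  φ-drift-step : ∀ p a b → b ℕ.≤ m →
    M * M + φ (+[1+ p ] + + a - + b)
      ≤ ψ +[1+ p ] + (M * M - + 6 * ((+ a - + b) * (+ a - + b)))
          + (L - + 12 * +[1+ p ]) * (+ a - + b) + δ (+[1+ p ] + + a - + b)
  φ-drift-step p a b b≤m = begin
    M * M + φ j          ≤⟨ ℤP.+-monoʳ-≤ (M * M) (φ-≤-ψ+δ j (-M≤1+p+a-b p a b≤m)) ⟩
    M * M + (ψ j + δ j)  ≡⟨ expand M L +[1+ p ] (+ a) (+ b) (δ j) ⟩
    _                    ∎
    where
    open ℤP.≤-Reasoning
    j = +[1+ p ] + + a - + b
    expand : ∀ M L I A B D →
      M * M + ((+ 4 * L * (M * M) + L * (I + A - B) - + 6 * ((I + A - B) * (I + A - B))) + D)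
        ≡ (+ 4 * L * (M * M) + L * I - + 6 * (I * I)) + (M * M - + 6 * ((A - B) * (A - B)))
            + (L - + 12 * I) * (A - B) + D
    expand = solve-∀

  ∑²-δ-≤-0 : ∀ p → ∑² (suc m) (λ a b → δ (+[1+ p ] + + a - + b)) ≤ 0ℤ
  ∑²-δ-≤-0 p = begin
    ∑² (suc m) (λ a b → δ (+[1+ p ] + + a - + b))  ≤⟨ ∑-mono-≤ (suc m) (λ a _ → ∑-δ-≤-0 (suc p ℕ.+ a)) ⟩
    ∑ (suc m) (λ _ → 0ℤ)                          ≡⟨ ∑-const (suc m) 0ℤ ⟩
    + suc m * 0ℤ                                  ≡⟨ ℤP.*-zeroʳ (+ suc m) ⟩
    0ℤ                                            ∎
    where open ℤP.≤-Reasoning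

  φ-drift-+ : ∀ p → ∑² (suc m) (λ a b → M * M + φ (+[1+ p ] + + a - + b)) ≤ + suc m * + suc m * φ +[1+ p ]
  φ-drift-+ p = begin
    ∑² n (λ a b → M * M + φ (I + + a - + b))
      ≤⟨ ∑²-mono-≤ n (λ a b _ b<n → φ-drift-step p a b (ℕP.≤-pred b<n)) ⟩
    ∑² n (λ a b → ψ I + V a b + C * X a b + Δ a b)
      ≡⟨ trans (∑²-distrib-+ n _ Δ) (cong (_+ ∑² n Δ) (trans (∑²-distrib-+ n _ _)
               (cong (_+ ∑² n (λ a b → C * X a b)) (∑²-distrib-+ n _ V)))) ⟩
    ∑² n (λ _ _ → ψ I) + ∑² n V + ∑² n (λ a b → C * X a b) + ∑² n Δ
      ≡⟨ cong (λ v → v + ∑² n Δ) (cong₂ _+_ (cong₂ _+_ (∑²-const n (ψ I)) ∑²-drift)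
                                            (trans (sym (*-distribˡ-∑² n C X)) (cong (C *_) (∑²-diff n)))) ⟩
    + n * + n * ψ I + - (+ 2 * (+ n * + n * M)) + C * 0ℤ + ∑² n Δ
      ≤⟨ ℤP.+-monoʳ-≤ (+ n * + n * ψ I + - (+ 2 * (+ n * + n * M)) + C * 0ℤ) (∑²-δ-≤-0 p) ⟩
    + n * + n * ψ I + - (+ 2 * (+ n * + n * M)) + C * 0ℤ + 0ℤ
      ≡⟨ tidy (+ n * + n * ψ I) (+ 2 * (+ n * + n * M)) C ⟩
    + n * + n * ψ I - + 2 * (+ n * + n * M)
      ≤⟨ ℤP.i-j≤i (+ n * + n * ψ I) (+ 2 * (+ n * + n * M)) {{ℤ.nonNegative 0≤2nnM}} ⟩
    + n * + n * ψ I ∎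
    where
    open ℤP.≤-Reasoning
    n = suc m
    I = +[1+ p ]
    C = L - + 12 * I
    X V Δ : ℕ → ℕ → ℤ
    X a b = + a - + b
    V a b = M * M - + 6 * (X a b * X a b)
    Δ a b = δ (I + + a - + b)
    0≤2nnM : 0ℤ ≤ + 2 * (+ n * + n * M)
    0≤2nnM = *-nonNeg (0≤+ 2)
               (*-nonNeg (*-nonNeg (0≤+ n) (0≤+ n)) (0≤+ m))
    tidy : ∀ P Q C → P + - Q + C * 0ℤ + 0ℤ ≡ P - Q
    tidy = solve-∀

  φ-even : ∀ j → φ (- j) ≡ φ j
  φ-even (+ zero) = refl
  φ-even +[1+ k ] = refl
  φ-even -[1+ k ] = refl

  φ-drift : ∀ i → i ≢ 0ℤ → ∑² (suc m) (λ a b → M * M + φ (i + + a - + b)) ≤ + suc m * + suc m * φ i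
  φ-drift (+ zero) i≢0 = ⊥-elim (i≢0 refl)
  φ-drift +[1+ p ] _   = φ-drift-+ p
  φ-drift -[1+ p ] _   = begin
    ∑² n (λ a b → M * M + φ (- I + + a - + b))
      ≡⟨ ∑²-cong n (λ a b → cong (λ v → M * M + v) (trans (cong φ (mirror I (+ a) (+ b))) (φ-even (I + + b - + a)))) ⟩
    ∑² n (λ a b → M * M + φ (I + + b - + a))
      ≡⟨ ∑²-swap n (λ a b → M * M + φ (I + + a - + b)) ⟨
    ∑² n (λ a b → M * M + φ (I + + a - + b))
      ≤⟨ φ-drift-+ p ⟩
    + n * + n * φ I ∎
    where
    open ℤP.≤-Reasoning
    n = suc m
    I = +[1+ p ]
    mirror : ∀ I A B → - I + A - B ≡ - (I + B - A)
    mirror = solve-∀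

  ψ-nonNeg : ∀ y → y ℕ.≤ s ℕ.* m → 0ℤ ≤ ψ (+ y)
  ψ-nonNeg y y≤sm = subst (λ Z → 0ℤ ≤ Ψ Z M (+ y)) S*M≡y+d (Ψ-nonNeg y (s ℕ.* m ℕ.∸ y) m)
    where
    S*M≡y+d : + y + + (s ℕ.* m ℕ.∸ y) ≡ S * M
    S*M≡y+d = trans (sym (ℤP.pos-+ y _)) (trans (cong +_ (ℕP.m+[n∸m]≡n y≤sm)) (ℤP.pos-* s m))

  ψ-exit : ∀ {R} → 6 ℕ.≤ s → R ℕ.≤ s ℕ.* s →
           ∀ y → s ℕ.* m ℕ.< y → y ℕ.≤ s ℕ.* m ℕ.+ m → M * M * + R ≤ ψ (+ y)
  ψ-exit {R} 6≤s R≤ss y sm<y y≤sm+m = begin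
    M * M * + R      ≤⟨ ℤP.*-monoˡ-≤-nonNeg (M * M) {{ℤ.nonNegative (*-nonNeg (0≤+ m) (0≤+ m))}}
                          (subst (+ R ≤_) (ℤP.pos-* s s) (+≤+ R≤ss)) ⟩
    M * M * (S * S)  ≤⟨ subst₂ (λ S′ M′ → M′ * M′ * (S′ * S′) ≤ Ψ (S′ * M′) M′ (S′ * M′ + + d))
                               6+u≡s d+e≡m
                               (Ψ-exit (s ℕ.∸ 6) d (m ℕ.∸ d)) ⟩
    ψ (S * M + + d)  ≡⟨ cong ψ sm+d≡y ⟩
    ψ (+ y)          ∎
    where
    open ℤP.≤-Reasoning
    d = y ℕ.∸ s ℕ.* m
    d≤m : d ℕ.≤ m
    d≤m = ℕP.≤-trans (ℕP.∸-monoˡ-≤ (s ℕ.* m) y≤sm+m) (ℕP.≤-reflexive (ℕP.m+n∸m≡n (s ℕ.* m) m))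
    6+u≡s : + 6 + + (s ℕ.∸ 6) ≡ S
    6+u≡s = cong +_ (ℕP.m+[n∸m]≡n 6≤s)
    d+e≡m : + d + + (m ℕ.∸ d) ≡ M
    d+e≡m = cong +_ (ℕP.m+[n∸m]≡n d≤m)
    sm+d≡y : S * M + + d ≡ + y
    sm+d≡y = trans (cong (_+ + d) (sym (ℤP.pos-* s m)))
                   (trans (sym (ℤP.pos-+ (s ℕ.* m) d)) (cong +_ (ℕP.m+[n∸m]≡n (ℕP.<⇒≤ sm<y))))

  φ-nonNeg : ∀ j → ∣ j ∣ ℕ.≤ s ℕ.* m → 0ℤ ≤ φ j
  φ-nonNeg (+ zero) _ = ℤP.≤-refl
  φ-nonNeg +[1+ k ] k<sm = ψ-nonNeg (suc k) k<sm
  φ-nonNeg -[1+ k ] k<sm = ψ-nonNeg (suc k) k<sm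

  φ-exit : ∀ {R} → 6 ℕ.≤ s → R ℕ.≤ s ℕ.* s →
           ∀ j → s ℕ.* m ℕ.< ∣ j ∣ → ∣ j ∣ ℕ.≤ s ℕ.* m ℕ.+ m → M * M * + R ≤ φ j
  φ-exit 6≤s R≤ss (+ zero) ()
  φ-exit 6≤s R≤ss +[1+ k ] = ψ-exit 6≤s R≤ss (suc k)
  φ-exit 6≤s R≤ss -[1+ k ] = ψ-exit 6≤s R≤ss (suc k)

  ψ-≤ : ∀ y → ψ (+ y) ≤ + 4 * L * (M * M) + L * + y
  ψ-≤ y = ℤP.i-j≤i _ (+ 6 * (+ y * + y)) {{ℤ.nonNegative (*-nonNeg (0≤+ 6) (*-nonNeg (0≤+ y) (0≤+ y)))}}

  φ-≤ : ∀ j → φ j ≤ + 4 * L * (M * M) + L * + ∣ j ∣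
  φ-≤ (+ zero) = ℤP.+-mono-≤ (*-nonNeg (*-nonNeg (0≤+ 4) 0≤L) (*-nonNeg (0≤+ m) (0≤+ m))) (*-nonNeg 0≤L (0≤+ 0))
  φ-≤ +[1+ k ] = ψ-≤ (suc k)
  φ-≤ -[1+ k ] = ψ-≤ (suc k)

m*cappedHitSum-≤ : ∀ m .{{_ : NonZero m}} s R → 6 ℕ.≤ s → R ℕ.≤ s ℕ.* s → ∀ I →
  + m * + cappedHitSum m R I ≤ + #paths m R * (+ 32 * + s * (+ m * + m + + ∣ I ∣))
m*cappedHitSum-≤ m@(suc _) s R 6≤s R≤ss I with ∣ I ∣ ℕ.≤? s ℕ.* m
... | yes inside = ℤP.*-cancelˡ-≤-pos _ _ M (begin
  M * (M * H)                               ≡⟨ ℤP.*-assoc M M H ⟨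
  M * M * H                                 ≤⟨ cappedHitSum-bound R ℕP.≤-refl I inside ⟩
  P * φ I                                   ≤⟨ ℤP.*-monoˡ-≤-nonNeg P (φ-≤ I) ⟩
  P * (+ 4 * L * (M * M) + L * Y)           ≤⟨ ℤP.*-monoˡ-≤-nonNeg P
                                                 (ℤP.i≤i+j _ (+ 24 * S * M * Y) {{ℤ.nonNegative 0≤24SMY}}) ⟩
  P * (+ 4 * L * (M * M) + L * Y + + 24 * S * M * Y) ≡⟨ regroup P S M Y ⟩
  M * (P * (+ 32 * S * (M * M + Y)))        ∎)
  where
  open Potential m s
  open LyapunovBound m (s ℕ.* m) R (M * M) (*-nonNeg (0≤+ m) (0≤+ m))
                     φ φ-nonNeg (φ-exit 6≤s R≤ss) (λ i i≢0 _ → φ-drift i i≢0)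
  open ℤP.≤-Reasoning
  H = + cappedHitSum m R I
  P = + #paths m R
  Y = + ∣ I ∣
  0≤24SMY : 0ℤ ≤ + 24 * S * M * Y
  0≤24SMY = *-nonNeg (*-nonNeg (*-nonNeg (0≤+ 24) (0≤+ s)) (0≤+ m)) (0≤+ ∣ I ∣)
  regroup : ∀ P S M Y → P * (+ 4 * (+ 8 * (S * M)) * (M * M) + (+ 8 * (S * M)) * Y + + 24 * S * M * Y)
                      ≡ M * (P * (+ 32 * S * (M * M + Y)))
  regroup = solve-∀
... | no outside = begin
  M * H                              ≤⟨ ℤP.*-monoˡ-≤-nonNeg M (cappedHitSum-≤ m R I) ⟩
  M * (+ R * P)                      ≤⟨ ℤP.*-monoˡ-≤-nonNeg M (ℤP.*-monoʳ-≤-nonNeg P R≤SS) ⟩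
  M * (S * S * P)                    ≡⟨ reorder M S P ⟩
  P * (S * (S * M))                  ≤⟨ ℤP.*-monoˡ-≤-nonNeg P (ℤP.*-monoˡ-≤-nonNeg S SM≤Y) ⟩
  P * (S * Y)                        ≤⟨ ℤP.*-monoˡ-≤-nonNeg P (ℤP.i≤j+i _ W {{ℤ.nonNegative 0≤W}}) ⟩
  P * (W + S * Y)                    ≡⟨ cong (P *_) (collect S M Y) ⟩
  P * (+ 32 * S * (M * M + Y))       ∎
  where
  open ℤP.≤-Reasoning
  M = + m
  S = + s
  H = + cappedHitSum m R I
  P = + #paths m R
  Y = + ∣ I ∣
  R≤SS : + R ≤ S * S
  R≤SS = subst (+ R ≤_) (ℤP.pos-* s s) (+≤+ R≤ss)
  SM≤Y : S * M ≤ Y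
  SM≤Y = subst (_≤ Y) (ℤP.pos-* s m) (+≤+ (ℕP.<⇒≤ (ℕP.≰⇒> outside)))
  W : ℤ
  W = + 32 * S * (M * M) + + 31 * S * Y
  0≤W : 0ℤ ≤ W
  0≤W = ℤP.+-mono-≤ (*-nonNeg (*-nonNeg (0≤+ 32) (0≤+ s)) (*-nonNeg (0≤+ m) (0≤+ m)))
                    (*-nonNeg (*-nonNeg (0≤+ 31) (0≤+ s)) (0≤+ ∣ I ∣))
  reorder : ∀ M S P → M * (S * S * P) ≡ P * (S * (S * M))
  reorder = solve-∀
  collect : ∀ S M Y → + 32 * S * (M * M) + + 31 * S * Y + S * Y ≡ + 32 * S * (M * M + Y)
  collect = solve-∀

1≤-of-square : ∀ {n t} → suc n ℕ.≤ t ℕ.* t → 1 ℕ.≤ t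
1≤-of-square {t = zero}  ()
1≤-of-square {t = suc _} _ = s≤s z≤n

sqrt-bracket : ∀ r → ∃ λ t → suc r ℕ.≤ t ℕ.* t × t ℕ.* t ℕ.≤ 4 ℕ.* suc r
sqrt-bracket zero = 1 , s≤s z≤n , s≤s z≤n
sqrt-bracket (suc r) with sqrt-bracket r
... | t , lo , hi with suc (suc r) ℕ.≤? t ℕ.* t
...   | yes lo′ = t , lo′ , ℕP.≤-trans hi (ℕP.*-monoʳ-≤ 4 (ℕP.n≤1+n (suc r)))
...   | no  ¬lo′ = suc t , lower , upper
  where
  tt≡1+r : t ℕ.* t ≡ suc r
  tt≡1+r = ℕP.≤-antisym (ℕP.≤-pred (ℕP.≰⇒> ¬lo′)) lo
  1≤t : 1 ℕ.≤ t
  1≤t = 1≤-of-square {t = t} lo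
  lower : suc (suc r) ℕ.≤ suc t ℕ.* suc t
  lower = subst (ℕ._≤ suc t ℕ.* suc t) (cong suc tt≡1+r)
                (s≤s (ℕP.≤-trans (ℕP.*-monoʳ-≤ t (ℕP.n≤1+n t)) (ℕP.m≤n+m (t ℕ.* suc t) t)))
  upper : suc t ℕ.* suc t ℕ.≤ 4 ℕ.* suc (suc r)
  upper = begin
    suc t ℕ.* suc t        ≤⟨ ℕP.*-mono-≤ 1+t≤t+t 1+t≤t+t ⟩
    (t ℕ.+ t) ℕ.* (t ℕ.+ t) ≡⟨ double-square t ⟩
    4 ℕ.* (t ℕ.* t)         ≡⟨ cong (4 ℕ.*_) tt≡1+r ⟩
    4 ℕ.* suc r             ≤⟨ ℕP.*-monoʳ-≤ 4 (ℕP.n≤1+n (suc r)) ⟩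
    4 ℕ.* suc (suc r)       ∎
    where
    open ℕP.≤-Reasoning
    1+t≤t+t : suc t ℕ.≤ t ℕ.+ t
    1+t≤t+t = ℕP.+-monoˡ-≤ t 1≤t
    double-square : ∀ t → (t ℕ.+ t) ℕ.* (t ℕ.+ t) ≡ 4 ℕ.* (t ℕ.* t)
    double-square = ℕ-Solver.solve-∀

square-mono : ∀ {x y} → 0ℤ ≤ x → x ≤ y → x * x ≤ y * y
square-mono {x} {y} 0≤x x≤y =
  ℤP.≤-trans (ℤP.*-monoˡ-≤-nonNeg x {{ℤ.nonNegative 0≤x}} x≤y)
             (ℤP.*-monoʳ-≤-nonNeg y {{ℤ.nonNegative (ℤP.≤-trans 0≤x x≤y)}} x≤y)

cappedHitSum-square-bound : ∀ m .{{_ : NonZero m}} I r →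
  let H = + cappedHitSum m (suc r) I ; P = + #paths m (suc r) ; K = + m * + m + + ∣ I ∣ in
  H * H * (+ m * + m) ≤ (+ 384 * K) * (+ 384 * K) * + suc r * (P * P)
cappedHitSum-square-bound m I r with sqrt-bracket r
... | t , lo , hi = begin
  H * H * (M * M)                              ≡⟨ swap H M ⟩
  (M * H) * (M * H)                            ≤⟨ square-mono (*-nonNeg (0≤+ m) (0≤+ (cappedHitSum m R I)))
                                                                  (m*cappedHitSum-≤ m s R 6≤s R≤ss I) ⟩
  (P * (+ 32 * S * K)) * (P * (+ 32 * S * K))  ≡⟨ regroup P S K ⟩
  P * P * (K * K) * (+ 32 * S * (+ 32 * S))    ≤⟨ ℤP.*-monoˡ-≤-nonNeg (P * P * (K * K)) {{ℤ.nonNegative 0≤PPKK}}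
                                                                         32S-squared ⟩
  P * P * (K * K) * (+ 384 * + 384 * + R)      ≡⟨ regroup′ P K (+ R) ⟩
  (+ 384 * K) * (+ 384 * K) * + R * (P * P)    ∎
  where
  open ℤP.≤-Reasoning
  R = suc r
  s = 6 ℕ.* t
  M = + m
  S = + s
  T = + t
  H = + cappedHitSum m R I
  P = + #paths m R
  K = M * M + + ∣ I ∣
  0≤PPKK : 0ℤ ≤ P * P * (K * K)
  0≤PPKK = *-nonNeg (*-nonNeg (0≤+ (#paths m R)) (0≤+ (#paths m R))) (*-nonNeg 0≤K 0≤K)
    where
    0≤K : 0ℤ ≤ K
    0≤K = ℤP.+-mono-≤ (*-nonNeg (0≤+ m) (0≤+ m)) (0≤+ ∣ I ∣)
  6≤s : 6 ℕ.≤ s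
  6≤s = ℕP.*-monoʳ-≤ 6 (1≤-of-square {t = t} lo)
  R≤ss : R ℕ.≤ s ℕ.* s
  R≤ss = ℕP.≤-trans lo (ℕP.≤-trans (ℕP.m≤n*m (t ℕ.* t) 36) (ℕP.≤-reflexive (six-squared t)))
    where
    six-squared : ∀ t → 36 ℕ.* (t ℕ.* t) ≡ 6 ℕ.* t ℕ.* (6 ℕ.* t)
    six-squared = ℕ-Solver.solve-∀
  32S-squared : + 32 * S * (+ 32 * S) ≤ + 384 * + 384 * + R
  32S-squared = begin
    + 32 * S * (+ 32 * S)          ≡⟨ cong (λ x → + 32 * x * (+ 32 * x)) (ℤP.pos-* 6 t) ⟩
    + 32 * (+ 6 * T) * (+ 32 * (+ 6 * T)) ≡⟨ expand T ⟩
    + 36864 * (T * T)              ≤⟨ ℤP.*-monoˡ-≤-nonNeg (+ 36864)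
                                        (subst₂ _≤_ (ℤP.pos-* t t) (ℤP.pos-* 4 R) (+≤+ hi)) ⟩
    + 36864 * (+ 4 * + R)          ≡⟨ collapse (+ R) ⟩
    + 384 * + 384 * + R            ∎
    where
    expand : ∀ T → + 32 * (+ 6 * T) * (+ 32 * (+ 6 * T)) ≡ + 36864 * (T * T)
    expand = solve-∀
    collapse : ∀ R → + 36864 * (+ 4 * R) ≡ + 384 * + 384 * R
    collapse = solve-∀
  swap : ∀ H M → H * H * (M * M) ≡ (M * H) * (M * H)
  swap = solve-∀
  regroup : ∀ P S K → (P * (+ 32 * S * K)) * (P * (+ 32 * S * K)) ≡ P * P * (K * K) * (+ 32 * S * (+ 32 * S))
  regroup = solve-∀
  regroup′ : ∀ P K R → P * P * (K * K) * (+ 384 * + 384 * R) ≡ (+ 384 * K) * (+ 384 * K) * R * (P * P)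
  regroup′ = solve-∀

toℚᵘ-/ : ∀ a c .{{_ : NonZero c}} → toℚᵘ (a ℚ./ c) ≃ a ℚᵘ./ c
toℚᵘ-/ a (suc c) = ℚP.toℚᵘ-fromℚᵘ (mkℚᵘ a c)

/-*-/ : ∀ a b c d .{{_ : NonZero c}} .{{_ : NonZero d}} →
        (a ℚ./ c) ℚ.* (b ℚ./ d) ≡ ((a * b) ℚ./ (c ℕ.* d)) {{ℕP.m*n≢0 c d}}
/-*-/ a b c@(suc _) d@(suc _) = ℚP.toℚᵘ-injective (begin
  toℚᵘ ((a ℚ./ c) ℚ.* (b ℚ./ d))      ≈⟨ ℚP.toℚᵘ-homo-* (a ℚ./ c) (b ℚ./ d) ⟩
  toℚᵘ (a ℚ./ c) ℚᵘ.* toℚᵘ (b ℚ./ d)  ≈⟨ ℚᵘP.*-cong (toℚᵘ-/ a c) (toℚᵘ-/ b d) ⟩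
  (a * b) ℚᵘ./ (c ℕ.* d)              ≈⟨ toℚᵘ-/ (a * b) (c ℕ.* d) ⟨
  toℚᵘ ((a * b) ℚ./ (c ℕ.* d))        ∎)
  where open ℚᵘP.≃-Reasoning

/-+-/ : ∀ a b c d .{{_ : NonZero c}} .{{_ : NonZero d}} →
        (a ℚ./ c) ℚ.+ (b ℚ./ d) ≡ ((a * + d + b * + c) ℚ./ (c ℕ.* d)) {{ℕP.m*n≢0 c d}}
/-+-/ a b c@(suc _) d@(suc _) = ℚP.toℚᵘ-injective (begin
  toℚᵘ ((a ℚ./ c) ℚ.+ (b ℚ./ d))            ≈⟨ ℚP.toℚᵘ-homo-+ (a ℚ./ c) (b ℚ./ d) ⟩
  toℚᵘ (a ℚ./ c) ℚᵘ.+ toℚᵘ (b ℚ./ d)        ≈⟨ ℚᵘP.+-cong (toℚᵘ-/ a c) (toℚᵘ-/ b d) ⟩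
  (a * + d + b * + c) ℚᵘ./ (c ℕ.* d)        ≈⟨ toℚᵘ-/ (a * + d + b * + c) (c ℕ.* d) ⟨
  toℚᵘ ((a * + d + b * + c) ℚ./ (c ℕ.* d))  ∎)
  where open ℚᵘP.≃-Reasoning

/-≤-/ : ∀ a b c d .{{_ : NonZero c}} .{{_ : NonZero d}} → a * + d ≤ b * + c → a ℚ./ c ℚ.≤ b ℚ./ d
/-≤-/ a b c@(suc _) d@(suc _) ad≤bc = ℚP.toℚᵘ-cancel-≤
  (ℚᵘP.≤-respˡ-≃ (ℚᵘP.≃-sym (toℚᵘ-/ a c)) (ℚᵘP.≤-respʳ-≃ (ℚᵘP.≃-sym (toℚᵘ-/ b d)) (*≤* ad≤bc)))

scale-/ : ∀ C m .{{_ : NonZero m}} y →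
  ((+ C) ℚ./ 1) ℚ.* ((+ m) ℚ./ 1 ℚ.+ y ℚ./ m) ≡ (+ C * (+ m * + m + y)) ℚ./ m
scale-/ C m y = begin
  ((+ C) ℚ./ 1) ℚ.* ((+ m) ℚ./ 1 ℚ.+ y ℚ./ m)
    ≡⟨ cong (λ q → ((+ C) ℚ./ 1) ℚ.* q) (/-+-/ (+ m) y 1 m) ⟩
  ((+ C) ℚ./ 1) ℚ.* ((+ m * + m + y * + 1) ℚ./ (1 ℕ.* m))
    ≡⟨ cong (λ q → ((+ C) ℚ./ 1) ℚ.* q) (ℚP./-cong (cong (λ z → + m * + m + z) (ℤP.*-identityʳ y)) (ℕP.*-identityˡ m)) ⟩
  ((+ C) ℚ./ 1) ℚ.* ((+ m * + m + y) ℚ./ m)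
    ≡⟨ trans (/-*-/ (+ C) (+ m * + m + y) 1 m) (ℚP./-cong {p₁ = + C * (+ m * + m + y)} refl (ℕP.*-identityˡ m)) ⟩
  (+ C * (+ m * + m + y)) ℚ./ m ∎
  where
  open ≡-Reasoning
  instance _ = ℕP.m*n≢0 1 m

square-times-/ : ∀ x m .{{_ : NonZero m}} r →
  ((x ℚ./ m) ℚ.* (x ℚ./ m)) ℚ.* ((+ r) ℚ./ 1) ≡ ((x * x * + r) ℚ./ (m ℕ.* m)) {{ℕP.m*n≢0 m m}}
square-times-/ x m r = begin
  ((x ℚ./ m) ℚ.* (x ℚ./ m)) ℚ.* ((+ r) ℚ./ 1)
    ≡⟨ cong (ℚ._* ((+ r) ℚ./ 1)) (/-*-/ x x m m) ⟩
  ((x * x) ℚ./ (m ℕ.* m)) ℚ.* ((+ r) ℚ./ 1)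
    ≡⟨ /-*-/ (x * x) (+ r) (m ℕ.* m) 1 ⟩
  ((x * x * + r) ℚ./ (m ℕ.* m ℕ.* 1))
    ≡⟨ ℚP./-cong {p₁ = x * x * + r} refl (ℕP.*-identityʳ (m ℕ.* m)) ⟩
  ((x * x * + r) ℚ./ (m ℕ.* m)) ∎
  where
  open ≡-Reasoning
  instance
    _ = ℕP.m*n≢0 m m
    _ = ℕP.m*n≢0 (m ℕ.* m) 1

expMinTr-square-≤ : (m : ℕ) → .{{_ : NonZero m}} → (I₀ : ℤ) → (r : ℕ) → .{{_ : NonZero r}} →
  expMinTr m I₀ r ℚ.* expMinTr m I₀ r
    ℚ.≤ ((((+ 384) ℚ./ 1) ℚ.* (((+ m) ℚ./ 1) ℚ.+ (+ ℤ.∣ I₀ ∣) ℚ./ m))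
         ℚ.* (((+ 384) ℚ./ 1) ℚ.* (((+ m) ℚ./ 1) ℚ.+ (+ ℤ.∣ I₀ ∣) ℚ./ m)))
       ℚ.* ((+ r) ℚ./ 1)
expMinTr-square-≤ m I₀ r@(suc r′) = begin
  expMinTr m I₀ r ℚ.* expMinTr m I₀ r          ≡⟨ /-*-/ H H P P ⟩
  (H * H) ℚ./ (P ℕ.* P)                        ≤⟨ /-≤-/ (H * H) (X * X * + r) (P ℕ.* P) (m ℕ.* m) cleared ⟩
  (X * X * + r) ℚ./ (m ℕ.* m)                  ≡⟨ square-times-/ X m r ⟨
  ((X ℚ./ m) ℚ.* (X ℚ./ m)) ℚ.* ((+ r) ℚ./ 1)  ≡⟨ cong (λ q → (q ℚ.* q) ℚ.* ((+ r) ℚ./ 1))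
                                                      (scale-/ 384 m (+ ℤ.∣ I₀ ∣)) ⟨
  _                                            ∎
  where
  open ℚP.≤-Reasoning
  P = #paths m r
  instance
    _ = nzPow m r
    _ = ℕP.m*n≢0 m m
    _ = ℕP.m*n≢0 P P
  H = + cappedHitSum m r I₀
  X = + 384 * (+ m * + m + + ℤ.∣ I₀ ∣)
  cleared : H * H * + (m ℕ.* m) ≤ X * X * + r * + (P ℕ.* P)
  cleared = subst₂ _≤_ (cong (λ z → H * H * z) (sym (ℤP.pos-* m m))) (cong (λ z → X * X * + r * z) (sym (ℤP.pos-* P P)))
              (cappedHitSum-square-bound m I₀ r′)

lemma13 : ∃ λ (C : ℕ) →
    (m : ℕ) → .{{_ : NonZero m}} → (I₀ : ℤ) → (r : ℕ) → .{{_ : NonZero r}} →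
      expMinTr m I₀ r ℚ.* expMinTr m I₀ r
        ℚ.≤ ((((+ C) ℚ./ 1) ℚ.* (((+ m) ℚ./ 1) ℚ.+ (+ ℤ.∣ I₀ ∣) ℚ./ m))
             ℚ.* (((+ C) ℚ./ 1) ℚ.* (((+ m) ℚ./ 1) ℚ.+ (+ ℤ.∣ I₀ ∣) ℚ./ m)))
           ℚ.* ((+ r) ℚ./ 1)
lemma13 = 384 , expMinTr-square-≤
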